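{- Let $Q$ be a set of $n$ states, $I=\{1,\dots,k\}$, and let $B,B':I\to 2^{Q}$ be injective functions with the same range. Then $|T(n,k,B)|=|T(n,k,B')|$.
   Context: For injective $B:I\to 2^Q$ and a finite sequence $\alpha$ over $I$, let $U(\alpha)=\bigcup_i B(\alpha[i])$, $\mathrm{Cover}(\alpha)=\{j\in I: B(j)\subseteq U(\alpha)\}$, and $j\in\mathrm{Mini}(\alpha)$ iff $j\notin\mathrm{Cover}(\alpha)$ and for every $j'\in I\setminus\mathrm{Cover}(\alpha)$, $j'\ne j$ implies $B(j')\cup U(\alpha)\not\subset B(j)\cup U(\alpha)$, and $j'<j$ implies $B(j')\cup U(\alpha)\ne B(j)\cup U(\alpha)$. The tree $T(n,k,B)$ has as nodes the empty sequence (root) and all nonempty sequences $\alpha$ over $I$ with $\alpha[i]\in\mathrm{Mini}(\alpha[1..i-1])$ for all $i\in[1,|\alpha|]$, parent obtained by deleting the last entry; $|T(n,k,B)|$ is its number of non-root nodes. (Both $\mathrm{Cover}$ and $\mathrm{Mini}$ depend on $B$, and are computed with $B'$ for $T(n,k,B')$.) -}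

module Defs where

open import Data.Nat as ℕ using (ℕ; zero; suc; _+_)
open import Data.Fin as F using (Fin; _<_; _<?_)
open import Data.Fin.Properties using (all?)
open import Data.Fin.Subset using (Subset; _⊆_; _⊂_; _∪_; ⊥)
open import Data.Fin.Subset.Properties using (_⊆?_; _⊂?_)
open import Data.Bool.Properties as BoolP using ()
open import Data.Vec.Properties using (≡-dec)
open import Data.List using (List; []; _∷_; _++_; [_]; foldr; map; concatMap; filter; length; upTo; allFin)
open import Data.Nat.ListAction using (sum)
open import Data.List.Relation.Unary.All using (All)
open import Data.Unit using (⊤; tt)
open import Data.Product using (_×_; _,_)
open import Relation.Nullary using (¬_; Dec; yes; no)
open import Relation.Nullary.Decidable using (_×-dec_; ¬?; _→-dec_)
open import Relation.Binary.PropositionalEquality using (_≡_; _≢_)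
open import Data.Fin.Properties using () renaming (_≟_ to _≟ᶠ_)

-- Q = Fin n (the n states), I = Fin k (indices, ordered by Fin's <),
-- B : Fin k → Subset n  (a map I → 2^Q).

_≟ˢ_ : ∀ {n} (p q : Subset n) → Dec (p ≡ q)
_≟ˢ_ = ≡-dec BoolP._≟_

module _ {n k : ℕ} (B : Fin k → Subset n) where

  U : List (Fin k) → Subset n
  U = foldr (λ i acc → B i ∪ acc) ⊥

  Cover : List (Fin k) → Fin k → Set
  Cover α j = B j ⊆ U α

  Mini : List (Fin k) → Fin k → Set
  Mini α j =
    ¬ Cover α j
    × (∀ j' → ¬ Cover α j' → j' ≢ j → ¬ ((B j' ∪ U α) ⊂ (B j ∪ U α)))
    × (∀ j' → ¬ Cover α j' → j' < j → (B j' ∪ U α) ≢ (B j ∪ U α))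

  ValidFrom : List (Fin k) → List (Fin k) → Set
  ValidFrom pre []         = ⊤
  ValidFrom pre (j ∷ rest) = Mini pre j × ValidFrom (pre ++ [ j ]) rest

  -- α is a node of T(n,k,B): α[i] ∈ Mini(α[1..i-1]) for all i ∈ [1,|α|]
  IsNode : List (Fin k) → Set
  IsNode α = ValidFrom [] α

  Cover? : ∀ α j → Dec (Cover α j)
  Cover? α j = B j ⊆? U α

  Mini? : ∀ α j → Dec (Mini α j)
  Mini? α j =
    ¬? (Cover? α j)
    ×-dec all? (λ j' → ¬? (Cover? α j') →-dec ((¬? (j' ≟ᶠ j)) →-dec ¬? ((B j' ∪ U α) ⊂? (B j ∪ U α))))
    ×-dec all? (λ j' → ¬? (Cover? α j') →-dec ((j' <? j) →-dec ¬? ((B j' ∪ U α) ≟ˢ (B j ∪ U α))))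

  ValidFrom? : ∀ pre rest → Dec (ValidFrom pre rest)
  ValidFrom? pre []         = yes tt
  ValidFrom? pre (j ∷ rest) = Mini? pre j ×-dec ValidFrom? (pre ++ [ j ]) rest

  IsNode? : ∀ α → Dec (IsNode α)
  IsNode? α = ValidFrom? [] α

allFinList : ∀ {k} → List (Fin k)
allFinList {k} = allFin k

seqsOfLength : (k m : ℕ) → List (List (Fin k))
seqsOfLength k zero    = [ [] ]
seqsOfLength k (suc m) = concatMap (λ j → map (j ∷_) (seqsOfLength k m)) allFinList

-- |T(n,k,B)| : number of non-root nodes.  Every node has pairwise distinct
-- entries (an appended j lies in Cover afterwards, and Mini excludes Cover),
-- so every non-root node has length in [1,k]; we count nodes of those lengths.
sizeT : (n k : ℕ) → (Fin k → Subset n) → ℕ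
sizeT n k B = sum (map (λ m → length (filter (IsNode? B) (seqsOfLength k (suc m)))) (upTo k))

-- Mini α depends on α only through the covered set S = U α.  Matching j with i
-- when B j ∪ S = B' i ∪ S is a bijection between Mini B and Mini B' at S: both
-- keep the uncovered indices whose extension B j ∪ S is ⊂-minimal, one (the
-- least) index per extension, and which extensions occur depends only on the
-- range of B.  Hence prefixes with the same covered set have equally many valid
-- continuations of each length under B and B'; induct on the length, matching
-- the first entries and double counting the resulting sums.
module Submission where

open import Defs
open import Data.Nat using (ℕ)
open import Data.Fin using (Fin)
open import Data.Fin.Subset using (Subset)
open import Data.Product using (∃)
open import Function.Definitions using (Injective)
open import Relation.Binary.PropositionalEquality using (_≡_)

open import Data.Nat using (zero; suc; _+_)
open import Data.Nat.Properties using (+-identityʳ; +-0-commutativeMonoid)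
open import Data.Nat.ListAction using (sum)
open import Data.Fin using (_<_; fromℕ<; punchIn) renaming (zero to fzero; suc to fsuc)
open import Data.Fin.Properties using (¬∀⟶∃¬-smallest; toℕ-inject; toℕ-fromℕ<; toℕ-injective; punchInᵢ≢i; <-cmp)
open import Data.Fin.Subset using (_∈_; _⊆_; _⊂_; _∪_)
open import Data.Fin.Subset.Properties using (p⊆p∪q; x∈p∪q⁻; ∪-commutativeMonoid; ⊂-irref)
open import Data.List using (List; []; _∷_; _++_; _∷ʳ_; map; concatMap; filter; length; tabulate; allFin; upTo)
open import Data.List.Properties using (filter-++; length-++; length-map; map-tabulate; filter-≐; filter-none; map-cong)
open import Data.List.Relation.Unary.All using (universal)
open import Data.Product using (_×_; _,_; proj₁; proj₂)
open import Data.Sum using ([_,_]′)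
open import Function using (_∘_; id; _⇔_; mk⇔; Equivalence)
open import Relation.Nullary using (¬_; Dec; yes; no; contradiction)
open import Relation.Nullary.Decidable using (_×-dec_; ¬?; decidable-stable)
open import Relation.Unary using (Decidable)
open import Relation.Binary using (tri<; tri≈; tri>)
open import Relation.Binary.PropositionalEquality using (_≢_; refl; sym; trans; cong; cong₂; subst; subst₂; module ≡-Reasoning)
open import Algebra.Bundles using (CommutativeMonoid)
import Algebra.Properties.CommutativeSemigroup as CommutativeSemigroupProperties
open import Algebra.Properties.CommutativeMonoid.Sum +-0-commutativeMonoid
  using (sum-syntax; sum-remove; sum-cong-≗; sum-replicate-zero; ∑-comm)

open Equivalence using (to; from)

iverson : {P : Set} → Dec P → ℕ → ℕ
iverson (yes _) c = c
iverson (no _)  c = 0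

iverson-yes : {P : Set} (d : Dec P) {c : ℕ} → P → iverson d c ≡ c
iverson-yes (yes _) _  = refl
iverson-yes (no ¬p) p = contradiction p ¬p

iverson-no : {P : Set} (d : Dec P) {c : ℕ} → ¬ P → iverson d c ≡ 0
iverson-no (yes p) ¬p = contradiction p ¬p
iverson-no (no _)  _  = refl

iverson-cong : {P : Set} (d : Dec P) {x y : ℕ} → (P → x ≡ y) → iverson d x ≡ iverson d y
iverson-cong (yes p) x≡y = x≡y p
iverson-cong (no _)  _   = refl

∑-iverson-none : ∀ {k} {P : Fin k → Set} (P? : Decidable P) → (∀ i → ¬ P i) →
                 ∀ c → ∑[ i < k ] iverson (P? i) c ≡ 0
∑-iverson-none {k} P? ¬P c =
  trans (sum-cong-≗ (λ i → iverson-no (P? i) (¬P i))) (sum-replicate-zero k)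

∑-iverson-single : ∀ {k} {P : Fin k → Set} (P? : Decidable P) →
                   (∀ {i i'} → P i → P i' → i ≡ i') → ∀ {i₀} → P i₀ →
                   ∀ c → ∑[ i < k ] iverson (P? i) c ≡ c
∑-iverson-single {suc k} P? unique {i₀} p₀ c = begin
  ∑[ i < suc k ] iverson (P? i) c                               ≡⟨ sum-remove {i = i₀} (λ i → iverson (P? i) c) ⟩
  iverson (P? i₀) c + ∑[ j < k ] iverson (P? (punchIn i₀ j)) c  ≡⟨ cong₂ _+_ (iverson-yes (P? i₀) p₀) vanish ⟩
  c + 0                                                         ≡⟨ +-identityʳ c ⟩
  c                                                             ∎
  where
  open ≡-Reasoning
  vanish : ∑[ j < k ] iverson (P? (punchIn i₀ j)) c ≡ 0
  vanish = ∑-iverson-none (P? ∘ punchIn i₀) (λ j p → punchInᵢ≢i i₀ j (unique p p₀)) c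

∑-iverson-unique : ∀ {k} {P : Fin k → Set} (P? : Decidable P) {Q : Set} (Q? : Dec Q) →
                   Q ⇔ ∃ P → (∀ {i i'} → P i → P i' → i ≡ i') →
                   ∀ c → ∑[ i < k ] iverson (P? i) c ≡ iverson Q? c
∑-iverson-unique P? (yes q) Q⇔∃P unique c =
  ∑-iverson-single P? unique (proj₂ (to Q⇔∃P q)) c
∑-iverson-unique P? (no ¬q) Q⇔∃P unique c =
  ∑-iverson-none P? (λ i p → ¬q (from Q⇔∃P (i , p))) c

∑-iverson-matching : ∀ {k l} {A : Fin k → Set} {C : Fin l → Set} {R : Fin k → Fin l → Set}
  (A? : Decidable A) (C? : Decidable C) (R? : ∀ j i → Dec (R j i)) {f : Fin k → ℕ} {g : Fin l → ℕ} →
  (∀ j → A j ⇔ ∃ (R j)) → (∀ i → C i ⇔ ∃ λ j → R j i) →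
  (∀ {j i i'} → R j i → R j i' → i ≡ i') → (∀ {j j' i} → R j i → R j' i → j ≡ j') →
  (∀ {j i} → R j i → f j ≡ g i) →
  ∑[ j < k ] iverson (A? j) (f j) ≡ ∑[ i < l ] iverson (C? i) (g i)
∑-iverson-matching {k} {l} A? C? R? {f} {g} A⇔ C⇔ uniqueʳ uniqueˡ f≡g = begin
  ∑[ j < k ] iverson (A? j) (f j)                  ≡⟨ sum-cong-≗ rows ⟨
  ∑[ j < k ] ∑[ i < l ] iverson (R? j i) (f j)     ≡⟨ sum-cong-≗ (λ j → sum-cong-≗ λ i → iverson-cong (R? j i) f≡g) ⟩
  ∑[ j < k ] ∑[ i < l ] iverson (R? j i) (g i)     ≡⟨ ∑-comm (λ j i → iverson (R? j i) (g i)) ⟩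
  ∑[ i < l ] ∑[ j < k ] iverson (R? j i) (g i)     ≡⟨ sum-cong-≗ columns ⟩
  ∑[ i < l ] iverson (C? i) (g i)                  ∎
  where
  open ≡-Reasoning
  rows : ∀ j → ∑[ i < l ] iverson (R? j i) (f j) ≡ iverson (A? j) (f j)
  rows j = ∑-iverson-unique (R? j) (A? j) (A⇔ j) uniqueʳ (f j)
  columns : ∀ i → ∑[ j < k ] iverson (R? j i) (g i) ≡ iverson (C? i) (g i)
  columns i = ∑-iverson-unique (λ j → R? j i) (C? i) (C⇔ i) uniqueˡ (g i)

least-witness : ∀ {k} {P : Fin k → Set} → Decidable P → ∀ {i₀} → P i₀ →
                ∃ λ i → P i × (∀ {j} → j < i → ¬ P j)
least-witness {P = P} P? {i₀} p₀
  with ¬∀⟶∃¬-smallest _ (¬_ ∘ P) (¬? ∘ P?) (λ ∀¬P → ∀¬P i₀ p₀)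
... | i , ¬¬Pi , below = i , decidable-stable (P? i) ¬¬Pi , λ {j} j<i →
  subst (¬_ ∘ P) (toℕ-injective (trans (toℕ-inject (fromℕ< j<i)) (toℕ-fromℕ< j<i))) (below (fromℕ< j<i))

module _ {A : Set} {P : A → Set} (P? : Decidable P) where

  filter-map : ∀ {C : Set} (f : C → A) xs → filter P? (map f xs) ≡ map f (filter (P? ∘ f) xs)
  filter-map f []       = refl
  filter-map f (x ∷ xs) with P? (f x)
  ... | yes _ = cong (f x ∷_) (filter-map f xs)
  ... | no _  = filter-map f xs

  length-filter-concatMap : ∀ {C : Set} (f : C → List A) xs →
    length (filter P? (concatMap f xs)) ≡ sum (map (length ∘ filter P? ∘ f) xs)
  length-filter-concatMap f []       = refl
  length-filter-concatMap f (x ∷ xs) = begin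
    length (filter P? (f x ++ concatMap f xs))                  ≡⟨ cong length (filter-++ P? (f x) _) ⟩
    length (filter P? (f x) ++ filter P? (concatMap f xs))      ≡⟨ length-++ (filter P? (f x)) ⟩
    length (filter P? (f x)) + length (filter P? (concatMap f xs)) ≡⟨ cong (_ +_) (length-filter-concatMap f xs) ⟩
    length (filter P? (f x)) + sum (map (length ∘ filter P? ∘ f) xs) ∎
    where open ≡-Reasoning

length-filter-×-dec : ∀ {A : Set} {D : Set} {Q : A → Set} (D? : Dec D) (Q? : Decidable Q) xs →
  length (filter (λ x → D? ×-dec Q? x) xs) ≡ iverson D? (length (filter Q? xs))
length-filter-×-dec (yes d) Q? xs = cong length (filter-≐ _ Q? (proj₂ , (d ,_)) xs)
length-filter-×-dec (no ¬d) Q? xs = cong length (filter-none _ (universal (λ _ → ¬d ∘ proj₁) xs))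

sum-tabulate : ∀ {k} (f : Fin k → ℕ) → sum (tabulate f) ≡ ∑[ i < k ] f i
sum-tabulate {zero}  f = refl
sum-tabulate {suc k} f = cong (f fzero +_) (sum-tabulate (f ∘ fsuc))

p∪r≡q∪r∧q⊆r⇒p⊆r : ∀ {n} {p q r : Subset n} → p ∪ r ≡ q ∪ r → q ⊆ r → p ⊆ r
p∪r≡q∪r∧q⊆r⇒p⊆r {r = r} p∪r≡q∪r q⊆r x∈p =
  [ q⊆r , id ]′ (x∈p∪q⁻ _ r (subst (_ ∈_) p∪r≡q∪r (p⊆p∪q r x∈p)))

module _ {n k : ℕ} (B : Fin k → Subset n) where

  -- Mini B α is definitionally MiniAt (U B α).
  MiniAt : Subset n → Fin k → Set
  MiniAt S j =
    ¬ (B j ⊆ S)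
    × (∀ j' → ¬ (B j' ⊆ S) → j' ≢ j → ¬ ((B j' ∪ S) ⊂ (B j ∪ S)))
    × (∀ j' → ¬ (B j' ⊆ S) → j' < j → (B j' ∪ S) ≢ (B j ∪ S))

  MiniAt-unique : ∀ {S i i'} → MiniAt S i → MiniAt S i' → B i ∪ S ≡ B i' ∪ S → i ≡ i'
  MiniAt-unique {i = i} {i'} (uncovered , _ , first) (uncovered' , _ , first') same with <-cmp i i'
  ... | tri< i<i' _ _ = contradiction same (first' i uncovered i<i')
  ... | tri≈ _ i≡i' _ = i≡i'
  ... | tri> _ _ i'<i = contradiction (sym same) (first i' uncovered' i'<i)

  U-∷ʳ : ∀ α j → U B (α ∷ʳ j) ≡ B j ∪ U B α
  U-∷ʳ []      j = refl
  U-∷ʳ (x ∷ α) j = trans (cong (B x ∪_) (U-∷ʳ α j)) (x∙yz≈y∙xz (B x) (B j) (U B α))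
    where open CommutativeSemigroupProperties (CommutativeMonoid.commutativeSemigroup (∪-commutativeMonoid n))

module _ {n k : ℕ} {B B' : Fin k → Subset n}
         (B⊆B' : ∀ j → ∃ λ i → B j ≡ B' i) (B'⊆B : ∀ i → ∃ λ j → B' i ≡ B j) where

  MiniAt-transfer : ∀ {S j} → MiniAt B S j → ∃ λ i → MiniAt B' S i × B j ∪ S ≡ B' i ∪ S
  MiniAt-transfer {S} {j} (uncovered , minimal , _)
    with least-witness (λ i → (B' i ∪ S) ≟ˢ (B j ∪ S)) (cong (_∪ S) (sym (proj₂ (B⊆B' j))))
  ... | i , same , below = i , (uncovered' , minimal' , first') , sym same
    where
    uncovered' : ¬ (B' i ⊆ S)
    uncovered' = uncovered ∘ p∪r≡q∪r∧q⊆r⇒p⊆r (sym same)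
    minimal' : ∀ i' → ¬ (B' i' ⊆ S) → i' ≢ i → ¬ ((B' i' ∪ S) ⊂ (B' i ∪ S))
    minimal' i' uncovered-i' _ smaller with B'⊆B i'
    ... | j' , B'i'≡Bj' = minimal j' (uncovered-i' ∘ subst (_⊆ S) (sym B'i'≡Bj')) j'≢j smaller'
      where
      smaller' : (B j' ∪ S) ⊂ (B j ∪ S)
      smaller' = subst₂ _⊂_ (cong (_∪ S) B'i'≡Bj') same smaller
      j'≢j : j' ≢ j
      j'≢j refl = ⊂-irref refl smaller'
    first' : ∀ i' → ¬ (B' i' ⊆ S) → i' < i → (B' i' ∪ S) ≢ (B' i ∪ S)
    first' i' _ i'<i same' = below i'<i (trans same' same)

countExtensions : ∀ {n k} → (Fin k → Subset n) → List (Fin k) → ℕ → ℕ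
countExtensions {k = k} B pre m = length (filter (ValidFrom? B pre) (seqsOfLength k m))

countExtensions-suc : ∀ {n k} (B : Fin k → Subset n) pre m →
  countExtensions B pre (suc m) ≡ ∑[ j < k ] iverson (Mini? B pre j) (countExtensions B (pre ∷ʳ j) m)
countExtensions-suc {k = k} B pre m = begin
  length (filter V? (concatMap (λ j → map (j ∷_) seqs) (allFin k)))  ≡⟨ length-filter-concatMap V? _ (allFin k) ⟩
  sum (map extend (allFin k))                                        ≡⟨ cong sum (map-tabulate id extend) ⟩
  sum (tabulate extend)                                              ≡⟨ sum-tabulate extend ⟩
  ∑[ j < k ] extend j                                                ≡⟨ sum-cong-≗ extend-by ⟩
  ∑[ j < k ] iverson (Mini? B pre j) (countExtensions B (pre ∷ʳ j) m) ∎
  where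
  open ≡-Reasoning
  V? = ValidFrom? B pre
  seqs = seqsOfLength k m
  extend : Fin k → ℕ
  extend j = length (filter V? (map (j ∷_) seqs))
  extend-by : ∀ j → extend j ≡ iverson (Mini? B pre j) (countExtensions B (pre ∷ʳ j) m)
  extend-by j = begin
    length (filter V? (map (j ∷_) seqs))              ≡⟨ cong length (filter-map V? (j ∷_) seqs) ⟩
    length (map (j ∷_) (filter (V? ∘ (j ∷_)) seqs))   ≡⟨ length-map (j ∷_) (filter (V? ∘ (j ∷_)) seqs) ⟩
    length (filter (V? ∘ (j ∷_)) seqs)                ≡⟨ length-filter-×-dec (Mini? B pre j) (ValidFrom? B (pre ∷ʳ j)) seqs ⟩
    iverson (Mini? B pre j) (countExtensions B (pre ∷ʳ j) m) ∎

module _ {n k : ℕ} {B B' : Fin k → Subset n}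
         (B⊆B' : ∀ j → ∃ λ i → B j ≡ B' i) (B'⊆B : ∀ i → ∃ λ j → B' i ≡ B j) where

  countExtensions-transfer : ∀ m {pre pre'} → U B pre ≡ U B' pre' →
                             countExtensions B pre m ≡ countExtensions B' pre' m
  countExtensions-transfer zero    _ = refl
  countExtensions-transfer (suc m) {pre} {pre'} same = begin
    countExtensions B pre (suc m)
      ≡⟨ countExtensions-suc B pre m ⟩
    ∑[ j < k ] iverson (Mini? B pre j) (countExtensions B (pre ∷ʳ j) m)
      ≡⟨ ∑-iverson-matching (Mini? B pre) (Mini? B' pre') Matched? Mini⇔ Mini'⇔
           (λ (_ , mi , e) (_ , mi' , e') → MiniAt-unique B' (toS mi) (toS mi') (trans (sym e) e'))
           (λ (mj , _ , e) (mj' , _ , e') → MiniAt-unique B mj mj' (trans e (sym e')))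
           extensions-agree ⟩
    ∑[ i < k ] iverson (Mini? B' pre' i) (countExtensions B' (pre' ∷ʳ i) m)
      ≡⟨ countExtensions-suc B' pre' m ⟨
    countExtensions B' pre' (suc m) ∎
    where
    open ≡-Reasoning
    S = U B pre
    toS : ∀ {i} → Mini B' pre' i → MiniAt B' S i
    toS {i} = subst (λ T → MiniAt B' T i) (sym same)
    Matched : Fin k → Fin k → Set
    Matched j i = Mini B pre j × Mini B' pre' i × B j ∪ S ≡ B' i ∪ S
    Matched? : ∀ j i → Dec (Matched j i)
    Matched? j i = Mini? B pre j ×-dec Mini? B' pre' i ×-dec ((B j ∪ S) ≟ˢ (B' i ∪ S))
    Mini⇔ : ∀ j → Mini B pre j ⇔ ∃ (Matched j)
    Mini⇔ j = mk⇔ (λ mj → let i , mi , e = MiniAt-transfer B⊆B' B'⊆B mj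
                           in i , mj , subst (λ T → MiniAt B' T i) same mi , e)
                  (proj₁ ∘ proj₂)
    Mini'⇔ : ∀ i → Mini B' pre' i ⇔ ∃ λ j → Matched j i
    Mini'⇔ i = mk⇔ (λ mi → let j , mj , e = MiniAt-transfer B'⊆B B⊆B' (toS mi)
                            in j , mj , mi , sym e)
                   (proj₁ ∘ proj₂ ∘ proj₂)
    extensions-agree : ∀ {j i} → Matched j i → countExtensions B (pre ∷ʳ j) m ≡ countExtensions B' (pre' ∷ʳ i) m
    extensions-agree {j} {i} (_ , _ , e) = countExtensions-transfer m (begin
      U B (pre ∷ʳ j)    ≡⟨ U-∷ʳ B pre j ⟩
      B j ∪ S           ≡⟨ e ⟩
      B' i ∪ S          ≡⟨ cong (B' i ∪_) same ⟩
      B' i ∪ U B' pre'  ≡⟨ U-∷ʳ B' pre' i ⟨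
      U B' (pre' ∷ʳ i)  ∎)

mainTheorem6 : (n k : ℕ) (B B' : Fin k → Subset n)
    → Injective _≡_ _≡_ B → Injective _≡_ _≡_ B'
    → (∀ i → ∃ λ j → B i ≡ B' j) → (∀ j → ∃ λ i → B' j ≡ B i)
    → sizeT n k B ≡ sizeT n k B'
mainTheorem6 n k B B' _ _ B⊆B' B'⊆B =
  cong sum (map-cong (λ m → countExtensions-transfer B⊆B' B'⊆B (suc m) refl) (upTo k))
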